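{- For each $n\ge 0$, a primitive modified ascent sequence of length $n$ avoids the pattern $122$ if and only if it avoids the pattern $1232$; that is, $\mathrm{Prim}_n(122)=\mathrm{Prim}_n(1232)$.
   Context: A Cayley permutation of length $n$ is a word $x=x_1\cdots x_n$ of positive integers whose set of values is $\{1,\dots,k\}$ for some $k\le n$. A Cayley permutation $x$ contains $y=y_1\cdots y_k$ if there are indices $i_1<\cdots<i_k$ with $x_{i_s}<x_{i_t}\iff y_s<y_t$ and $x_{i_s}=x_{i_t}\iff y_s=y_t$ for all $s,t$; otherwise $x$ avoids $y$. The ascent tops of $x$ are the pairs $(1,x_1)$ and $(i,x_i)$ with $1<i\le n$ and $x_{i-1}<x_i$; the leftmost copies are the pairs $(\min\{i:x_i=j\},j)$ for $1\le j\le\max(x)$. A modified ascent sequence is a Cayley permutation whose set of ascent tops equals its set of leftmost copies; it is primitive if it has no two consecutive equal entries. $\mathrm{Prim}_n(y)$ is the set of primitive modified ascent sequences of length $n$ avoiding $y$. -}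

module Defs where

open import Data.Nat using (ℕ; zero; suc; _<_; _≤_; _⊔_)
open import Data.List using (List; []; _∷_; length; lookup; foldr)
open import Data.List.Membership.Propositional using (_∈_)
open import Data.List.Relation.Binary.Sublist.Propositional using (_⊆_)
open import Data.List.Relation.Unary.All using (All)
open import Data.Fin using (Fin; toℕ)
open import Data.Product using (_×_; Σ; ∃; ∃-syntax; _,_)
open import Function.Bundles using (_⇔_)
open import Data.Sum using (_⊎_)
open import Relation.Binary.PropositionalEquality using (_≡_)
open import Relation.Nullary using (¬_)

-- Words are lists of naturals; positions are Fin (length x), 0-based
-- (position p corresponds to index toℕ p + 1 in the paper).

maxL : List ℕ → ℕ
maxL = foldr _⊔_ 0

IsCayley : List ℕ → Set
IsCayley x = All (λ v → 1 ≤ v) x × (∀ j → 1 ≤ j → j ≤ maxL x → j ∈ x)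

OrderIso : List ℕ → List ℕ → Set
OrderIso u y = Σ (length u ≡ length y) λ eq →
  ∀ (s t : Fin (length u)) →
    ((lookup u s < lookup u t) ⇔ (lookup y (Data.Fin.cast eq s) < lookup y (Data.Fin.cast eq t)))
  × ((lookup u s ≡ lookup u t) ⇔ (lookup y (Data.Fin.cast eq s) ≡ lookup y (Data.Fin.cast eq t)))

Contains : List ℕ → List ℕ → Set
Contains x y = ∃[ u ] (u ⊆ x × OrderIso u y)

Avoids : List ℕ → List ℕ → Set
Avoids x y = ¬ Contains x y

IsAscentTop : (x : List ℕ) → Fin (length x) → ℕ → Set
IsAscentTop x p v =
  (v ≡ lookup x p) ×
  ((toℕ p ≡ 0) ⊎ (∃[ q ] (suc (toℕ q) ≡ toℕ p × lookup x q < lookup x p)))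

IsLeftmostCopy : (x : List ℕ) → Fin (length x) → ℕ → Set
IsLeftmostCopy x p j =
  1 ≤ j × j ≤ maxL x × lookup x p ≡ j ×
  (∀ (q : Fin (length x)) → toℕ q < toℕ p → ¬ (lookup x q ≡ j))

IsModAsc : List ℕ → Set
IsModAsc x = IsCayley x ×
  (∀ (p : Fin (length x)) (v : ℕ) → IsAscentTop x p v ⇔ IsLeftmostCopy x p v)

NoFlat : List ℕ → Set
NoFlat x = ∀ (p q : Fin (length x)) → suc (toℕ p) ≡ toℕ q → ¬ (lookup x p ≡ lookup x q)

IsPrimModAsc : List ℕ → Set
IsPrimModAsc x = IsModAsc x × NoFlat x

InPrim : ℕ → List ℕ → List ℕ → Set
InPrim n y x = IsPrimModAsc x × length x ≡ n × Avoids x y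

-- A 1232-occurrence (a, b, c, b) contains the 122-occurrence (a, b, b), so one inclusion holds for
-- all words. Conversely let (a, b, b) be a 122-occurrence in a primitive modified ascent sequence x,
-- the two b's at positions j < k. The leftmost copy of b is an ascent top at a position j' ≤ j, and
-- not the first position since x begins with 1 < b; so x_{j'-1} < b. The copy at k is not leftmost,
-- hence not an ascent top, and x has no flat steps, so x_{k-1} > b; in particular j' < k - 1.
-- Then (x_{j'-1}, b, x_{k-1}, b) is an occurrence of 1232.
module Submission where

open import Defs
open import Data.Nat using (ℕ; zero; suc; _+_; _<_; _≤_; z≤n; s≤s; pred)
open import Data.Nat.Properties
open import Data.List using (List; []; _∷_; length; lookup; map; drop)
open import Data.List.Relation.Binary.Sublist.Propositional
  using (_⊆_; _∷_; _∷ʳ_; ⊆-refl; ⊆-trans; minimum)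
open import Data.List.Relation.Binary.Sublist.Propositional.Properties using (Any-resp-⊆)
open import Data.List.Relation.Unary.All as All using (All; _∷_)
open import Data.List.Membership.Propositional using (_∈_)
open import Data.List.Membership.Propositional.Properties using (∈-lookup)
open import Data.List.Relation.Unary.Any as Any using (here)
open import Data.List.Relation.Unary.Any.Properties using (lookup-index)
open import Data.Fin using (Fin; toℕ; cast; inject₁) renaming (zero to fzero; suc to fsuc)
open import Data.Fin.Properties using (toℕ-injective; toℕ-inject₁)
open import Data.Product using (Σ-syntax; ∃-syntax; _×_; _,_; proj₁; proj₂)
open import Data.Sum using (inj₁; inj₂)
open import Data.Empty using (⊥-elim)
open import Function using (_∘_)
open import Function.Bundles using (_⇔_; mk⇔; Equivalence)
open import Relation.Binary.PropositionalEquality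
open import Relation.Nullary using (¬_; yes; no)
open import Relation.Binary.Definitions using (tri<; tri≈; tri>)
open import Data.List.Properties using (length-map)

IncreasingOnPositives : (ℕ → ℕ) → Set
IncreasingOnPositives f = ∀ {s t} → 1 ≤ s → s < t → f s < f t

module _ {f : ℕ → ℕ} (f-inc : IncreasingOnPositives f) {s t : ℕ} (1≤s : 1 ≤ s) (1≤t : 1 ≤ t) where

  increasingOnPositives-<⇔ : (f s < f t) ⇔ (s < t)
  increasingOnPositives-<⇔ = mk⇔ reflect (f-inc 1≤s)
    where
    reflect : f s < f t → s < t
    reflect fs<ft with <-cmp s t
    ... | tri< s<t _ _ = s<t
    ... | tri≈ _ refl _ = ⊥-elim (<-irrefl refl fs<ft)
    ... | tri> _ _ t<s = ⊥-elim (<-asym fs<ft (f-inc 1≤t t<s))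

  increasingOnPositives-≡⇔ : (f s ≡ f t) ⇔ (s ≡ t)
  increasingOnPositives-≡⇔ = mk⇔ reflect (cong f)
    where
    reflect : f s ≡ f t → s ≡ t
    reflect fs≡ft with <-cmp s t
    ... | tri< s<t _ _ = ⊥-elim (<-irrefl fs≡ft (f-inc 1≤s s<t))
    ... | tri≈ _ s≡t _ = s≡t
    ... | tri> _ _ t<s = ⊥-elim (<-irrefl (sym fs≡ft) (f-inc 1≤t t<s))

lookup-map-cast : (f : ℕ → ℕ) (y : List ℕ) (eq : length (map f y) ≡ length y)
  (s : Fin (length (map f y))) → lookup (map f y) s ≡ f (lookup y (cast eq s))
lookup-map-cast f (v ∷ y) eq fzero = refl
lookup-map-cast f (v ∷ y) eq (fsuc s) = lookup-map-cast f y (cong pred eq) s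

orderIso-map : {f : ℕ → ℕ} → IncreasingOnPositives f →
  (y : List ℕ) → All (1 ≤_) y → OrderIso (map f y) y
orderIso-map {f} f-inc y y-pos = eq , compare
  where
  eq : length (map f y) ≡ length y
  eq = length-map f y
  positive : ∀ s → 1 ≤ lookup y (cast eq s)
  positive s = All.lookup y-pos (∈-lookup (cast eq s))
  compare : ∀ s t →
    ((lookup (map f y) s < lookup (map f y) t) ⇔ (lookup y (cast eq s) < lookup y (cast eq t)))
    × ((lookup (map f y) s ≡ lookup (map f y) t) ⇔ (lookup y (cast eq s) ≡ lookup y (cast eq t)))
  compare s t rewrite lookup-map-cast f y eq s | lookup-map-cast f y eq t =
    increasingOnPositives-<⇔ f-inc (positive s) (positive t) ,
    increasingOnPositives-≡⇔ f-inc (positive s) (positive t)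

-- Sends 1, 2, 3 to a, b, c (the value at 0 is junk); n + c rather than c + n so that 3 ↦ c definitionally.
stair : ℕ → ℕ → ℕ → ℕ → ℕ
stair a b c 0 = a
stair a b c 1 = a
stair a b c 2 = b
stair a b c (suc (suc (suc n))) = n + c

stair-increasing : ∀ {a b c} → a < b → b < c → IncreasingOnPositives (stair a b c)
stair-increasing a<b b<c {1} {2} _ _ = a<b
stair-increasing {c = c} a<b b<c {1} {suc (suc (suc n))} _ _ = ≤-trans (<-trans a<b b<c) (m≤n+m c n)
stair-increasing {c = c} a<b b<c {2} {suc (suc (suc n))} _ _ = ≤-trans b<c (m≤n+m c n)
stair-increasing {c = c} a<b b<c {suc (suc (suc m))} {suc (suc (suc n))} _ (s≤s (s≤s (s≤s m<n))) =
  +-monoˡ-< c m<n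
stair-increasing _ _ {1} {1} _ (s≤s ())
stair-increasing _ _ {2} {1} _ (s≤s ())
stair-increasing _ _ {2} {2} _ (s≤s (s≤s ()))

contains-122⇔ : ∀ {x} → Contains x (1 ∷ 2 ∷ 2 ∷ []) ⇔ (∃[ a ] ∃[ b ] a < b × a ∷ b ∷ b ∷ [] ⊆ x)
contains-122⇔ = mk⇔ extract (λ (a , b , a<b , sub) →
  _ , sub , orderIso-map (stair-increasing a<b (n<1+n b)) (1 ∷ 2 ∷ 2 ∷ []) positive)
  where
  positive : All (1 ≤_) (1 ∷ 2 ∷ 2 ∷ [])
  positive = s≤s z≤n ∷ s≤s z≤n ∷ s≤s z≤n ∷ All.[]
  extract : ∀ {x} → Contains x (1 ∷ 2 ∷ 2 ∷ []) → ∃[ a ] ∃[ b ] a < b × a ∷ b ∷ b ∷ [] ⊆ x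
  extract (a ∷ b ∷ d ∷ [] , sub , refl , iso)
    rewrite sym (Equivalence.from (proj₂ (iso (fsuc fzero) (fsuc (fsuc fzero)))) refl) =
    a , b , Equivalence.from (proj₁ (iso fzero (fsuc fzero))) (s≤s (s≤s z≤n)) , sub

contains-1232⇔ : ∀ {x} →
  Contains x (1 ∷ 2 ∷ 3 ∷ 2 ∷ []) ⇔ (∃[ a ] ∃[ b ] ∃[ c ] a < b × b < c × a ∷ b ∷ c ∷ b ∷ [] ⊆ x)
contains-1232⇔ = mk⇔ extract (λ (a , b , c , a<b , b<c , sub) →
  _ , sub , orderIso-map (stair-increasing a<b b<c) (1 ∷ 2 ∷ 3 ∷ 2 ∷ []) positive)
  where
  positive : All (1 ≤_) (1 ∷ 2 ∷ 3 ∷ 2 ∷ [])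
  positive = s≤s z≤n ∷ s≤s z≤n ∷ s≤s z≤n ∷ s≤s z≤n ∷ All.[]
  extract : ∀ {x} → Contains x (1 ∷ 2 ∷ 3 ∷ 2 ∷ []) →
    ∃[ a ] ∃[ b ] ∃[ c ] a < b × b < c × a ∷ b ∷ c ∷ b ∷ [] ⊆ x
  extract (a ∷ b ∷ c ∷ d ∷ [] , sub , refl , iso)
    rewrite sym (Equivalence.from (proj₂ (iso (fsuc fzero) (fsuc (fsuc (fsuc fzero))))) refl) =
    a , b , c ,
    Equivalence.from (proj₁ (iso fzero (fsuc fzero))) (s≤s (s≤s z≤n)) ,
    Equivalence.from (proj₁ (iso (fsuc fzero) (fsuc (fsuc fzero)))) (s≤s (s≤s (s≤s z≤n))) , sub

contains-1232⇒contains-122 : ∀ {x} → Contains x (1 ∷ 2 ∷ 3 ∷ 2 ∷ []) → Contains x (1 ∷ 2 ∷ 2 ∷ [])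
contains-1232⇒contains-122 occ with Equivalence.to contains-1232⇔ occ
... | a , b , c , a<b , _ , sub =
  Equivalence.from contains-122⇔ (a , b , a<b , ⊆-trans (refl ∷ refl ∷ c ∷ʳ ⊆-refl) sub)

lookup∷⊆drop : ∀ (x : List ℕ) (i : Fin (length x)) {m u} → m ≤ toℕ i →
  u ⊆ drop (suc (toℕ i)) x → lookup x i ∷ u ⊆ drop m x
lookup∷⊆drop (v ∷ x) fzero {zero} z≤n sub = refl ∷ sub
lookup∷⊆drop (v ∷ x) (fsuc i) {zero} z≤n sub = v ∷ʳ lookup∷⊆drop x i z≤n sub
lookup∷⊆drop (v ∷ x) (fsuc i) {suc m} (s≤s m≤i) sub = lookup∷⊆drop x i m≤i sub

∷⊆drop⇒lookup : ∀ (x : List ℕ) m {a u} → a ∷ u ⊆ drop m x →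
  ∃[ i ] m ≤ toℕ i × lookup x i ≡ a × u ⊆ drop (suc (toℕ i)) x
∷⊆drop⇒lookup (v ∷ x) zero (v≡a ∷ sub) = fzero , z≤n , sym v≡a , sub
∷⊆drop⇒lookup (v ∷ x) zero (.v ∷ʳ sub) with ∷⊆drop⇒lookup x zero sub
... | i , _ , xᵢ≡a , sub′ = fsuc i , z≤n , xᵢ≡a , sub′
∷⊆drop⇒lookup (v ∷ x) (suc m) sub with ∷⊆drop⇒lookup x m sub
... | i , m≤i , xᵢ≡a , sub′ = fsuc i , s≤s m≤i , xᵢ≡a , sub′

lookup≤maxL : ∀ (x : List ℕ) (i : Fin (length x)) → lookup x i ≤ maxL x
lookup≤maxL (v ∷ x) fzero = m≤m⊔n v (maxL x)
lookup≤maxL (v ∷ x) (fsuc i) = ≤-trans (lookup≤maxL x i) (m≤n⊔m v (maxL x))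

leftmost-occurrence : ∀ (x : List ℕ) (j : Fin (length x)) →
  ∃[ j′ ] toℕ j′ ≤ toℕ j × lookup x j′ ≡ lookup x j ×
    (∀ q → toℕ q < toℕ j′ → lookup x q ≢ lookup x j)
leftmost-occurrence (v ∷ x) j with v ≟ lookup (v ∷ x) j
... | yes v≡xⱼ = fzero , z≤n , v≡xⱼ , λ _ ()
leftmost-occurrence (v ∷ x) fzero | no v≢v = ⊥-elim (v≢v refl)
leftmost-occurrence (v ∷ x) (fsuc j) | no v≢xⱼ with leftmost-occurrence x j
... | j′ , j′≤j , eq , earlier =
  fsuc j′ , s≤s j′≤j , eq , λ { fzero _ → v≢xⱼ ; (fsuc q) (s≤s q<j′) → earlier q q<j′ }

predecessor : ∀ {n} (k : Fin n) → 0 < toℕ k → Σ[ q ∈ Fin n ] suc (toℕ q) ≡ toℕ k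
predecessor (fsuc k) _ = inject₁ k , cong suc (toℕ-inject₁ k)

leftmost-occurrence-isAscentTop : ∀ {x} → IsModAsc x → (j : Fin (length x)) → 1 ≤ lookup x j →
  ∃[ j′ ] toℕ j′ ≤ toℕ j × IsAscentTop x j′ (lookup x j)
leftmost-occurrence-isAscentTop {x} (_ , ascentTop⇔leftmostCopy) j 1≤xⱼ
  with leftmost-occurrence x j
... | j′ , j′≤j , xⱼ′≡xⱼ , earlier = j′ , j′≤j ,
  Equivalence.from (ascentTop⇔leftmostCopy j′ (lookup x j))
    (1≤xⱼ , lookup≤maxL x j , xⱼ′≡xⱼ , earlier)

modAsc-head≡1 : ∀ {x} → IsModAsc x → (p : Fin (length x)) → toℕ p ≡ 0 → lookup x p ≡ 1
modAsc-head≡1 {x} modAsc@((positive , surjective) , _) p p≡0 =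
  occurrence-of-1 (Any.index 1∈x) (sym (lookup-index 1∈x))
  where
  1∈x : 1 ∈ x
  1∈x = surjective 1 ≤-refl (≤-trans (All.lookup positive (∈-lookup p)) (lookup≤maxL x p))
  occurrence-of-1 : ∀ i → lookup x i ≡ 1 → lookup x p ≡ 1
  occurrence-of-1 i xᵢ≡1 with leftmost-occurrence-isAscentTop modAsc i (≤-reflexive (sym xᵢ≡1))
  ... | j′ , _ , xᵢ≡xⱼ′ , inj₁ j′≡0 = begin
    lookup x p   ≡⟨ cong (lookup x) (toℕ-injective (trans p≡0 (sym j′≡0))) ⟩
    lookup x j′  ≡⟨ sym xᵢ≡xⱼ′ ⟩
    lookup x i   ≡⟨ xᵢ≡1 ⟩
    1            ∎
    where open ≡-Reasoning
  ... | j′ , _ , xᵢ≡xⱼ′ , inj₂ (q , _ , xq<xⱼ′) =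
    ⊥-elim (≤⇒≯ (All.lookup positive (∈-lookup q))
      (subst (lookup x q <_) (trans (sym xᵢ≡xⱼ′) xᵢ≡1) xq<xⱼ′))

leftmost-occurrence-after-smaller : ∀ {x} → IsModAsc x → (j : Fin (length x)) → 2 ≤ lookup x j →
  Σ[ q ∈ Fin (length x) ] Σ[ j′ ∈ Fin (length x) ]
    suc (toℕ q) ≡ toℕ j′ × toℕ j′ ≤ toℕ j × lookup x j′ ≡ lookup x j × lookup x q < lookup x j
leftmost-occurrence-after-smaller {x} modAsc j 2≤xⱼ
  with leftmost-occurrence-isAscentTop modAsc j (≤-trans (s≤s z≤n) 2≤xⱼ)
... | j′ , _ , xⱼ≡xⱼ′ , inj₁ j′≡0 =
  ⊥-elim (≤⇒≯ 2≤xⱼ (≤-reflexive (cong suc (trans xⱼ≡xⱼ′ (modAsc-head≡1 modAsc j′ j′≡0)))))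
... | j′ , j′≤j , xⱼ≡xⱼ′ , inj₂ (q , 1+q≡j′ , xq<xⱼ′) =
  q , j′ , 1+q≡j′ , j′≤j , sym xⱼ≡xⱼ′ , subst (lookup x q <_) (sym xⱼ≡xⱼ′) xq<xⱼ′

repeat-after-larger : ∀ {x} → IsPrimModAsc x → (j k : Fin (length x)) →
  toℕ j < toℕ k → lookup x j ≡ lookup x k →
  Σ[ k′ ∈ Fin (length x) ] suc (toℕ k′) ≡ toℕ k × lookup x k < lookup x k′
repeat-after-larger {x} ((_ , ascentTop⇔leftmostCopy) , noFlat) j k j<k xⱼ≡xₖ
  with predecessor k (≤-<-trans z≤n j<k)
... | k′ , 1+k′≡k = k′ , 1+k′≡k , ≤∧≢⇒< (≮⇒≥ no-ascent) (λ xₖ≡xₖ′ → noFlat k′ k 1+k′≡k (sym xₖ≡xₖ′))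
  where
  no-ascent : ¬ (lookup x k′ < lookup x k)
  no-ascent xₖ′<xₖ =
    let (_ , _ , _ , no-earlier) = Equivalence.to (ascentTop⇔leftmostCopy k (lookup x k))
                                     (refl , inj₂ (k′ , 1+k′≡k , xₖ′<xₖ))
    in no-earlier j j<k xⱼ≡xₖ

primModAsc-contains-122⇒contains-1232 : ∀ {x} → IsPrimModAsc x →
  Contains x (1 ∷ 2 ∷ 2 ∷ []) → Contains x (1 ∷ 2 ∷ 3 ∷ 2 ∷ [])
primModAsc-contains-122⇒contains-1232 {x} prim@(modAsc@((positive , _) , _) , _) occ
  with Equivalence.to contains-122⇔ occ
... | a , b , a<b , sub
  with ∷⊆drop⇒lookup x 0 (⊆-trans (a ∷ʳ ⊆-refl) sub)
... | j , _ , xⱼ≡b , sub′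
  with ∷⊆drop⇒lookup x (suc (toℕ j)) sub′
... | k , j<k , xₖ≡b , _
  with leftmost-occurrence-after-smaller modAsc j
         (subst (2 ≤_) (sym xⱼ≡b) (≤-trans (s≤s (All.lookup positive (Any-resp-⊆ sub (here refl)))) a<b))
... | q , j′ , 1+q≡j′ , j′≤j , xⱼ′≡xⱼ , xq<xⱼ
  with repeat-after-larger prim j′ k (≤-<-trans j′≤j j<k) (trans xⱼ′≡xⱼ (trans xⱼ≡b (sym xₖ≡b)))
... | k′ , 1+k′≡k , xₖ<xₖ′ =
  Equivalence.from contains-1232⇔ (lookup x q , lookup x j , lookup x k′ , xq<xⱼ , xⱼ<xₖ′ ,
    subst₂ (λ u v → lookup x q ∷ u ∷ lookup x k′ ∷ v ∷ [] ⊆ x) xⱼ′≡xⱼ xₖ≡xⱼ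
      (lookup∷⊆drop x q z≤n (lookup∷⊆drop x j′ (≤-reflexive 1+q≡j′)
        (lookup∷⊆drop x k′ j′<k′ (lookup∷⊆drop x k (≤-reflexive 1+k′≡k) (minimum _))))))
  where
  xₖ≡xⱼ : lookup x k ≡ lookup x j
  xₖ≡xⱼ = trans xₖ≡b (sym xⱼ≡b)
  xⱼ<xₖ′ : lookup x j < lookup x k′
  xⱼ<xₖ′ = subst (_< lookup x k′) xₖ≡xⱼ xₖ<xₖ′
  j′<k′ : toℕ j′ < toℕ k′
  j′<k′ = ≤∧≢⇒< (≤-pred (≤-trans (≤-<-trans j′≤j j<k) (≤-reflexive (sym 1+k′≡k))))
    (λ j′≡k′ → <-irrefl (trans (sym xⱼ′≡xⱼ) (cong (lookup x) (toℕ-injective j′≡k′))) xⱼ<xₖ′)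

lemma5p1 : (n : ℕ) (x : List ℕ) →
    InPrim n (1 ∷ 2 ∷ 2 ∷ []) x ⇔ InPrim n (1 ∷ 2 ∷ 3 ∷ 2 ∷ []) x
lemma5p1 n x = mk⇔
  (λ (prim , len , avoids-122) → prim , len , avoids-122 ∘ contains-1232⇒contains-122)
  (λ (prim , len , avoids-1232) → prim , len , avoids-1232 ∘ primModAsc-contains-122⇒contains-1232 prim)
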